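{- Let $A \subseteq \mathbb{N}$ and let $B \subseteq \mathbb{N}$ be a finite set. For each $b \in B$ let $\delta_b \in \mathbb{N} \cup \{\infty\}$. Suppose the identity of formal power series \[ 1 + \sum_{a \in A} x^a = \prod_{b \in B} \frac{1 - x^{b\delta_b}}{1 - x^b} \] holds, where for $\delta_b = \infty$ the term $x^{b\delta_b}$ is interpreted as $0$. Define $\mathcal{A} := A$ and \[ \mathcal{B} := \bigcup_{b \in B} (b\mathbb{N} \setminus b\delta_b \mathbb{N}), \] where for $\delta_b = \infty$ the set $b\delta_b\mathbb{N}$ is interpreted as $\emptyset$. If for all $b, b' \in B$ with $b \neq b'$ we have $(b\mathbb{N} \setminus b\delta_b\mathbb{N}) \cap (b'\mathbb{N} \setminus b'\delta_{b'}\mathbb{N}) = \emptyset$ (with the same interpretation when $\delta_b$ or $\delta_{b'}$ is $\infty$), then $P(\mathcal{A}; n) = Q(\mathcal{B}; n)$ for all $n \in \mathbb{N}$.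
   Context: $\mathbb{N} = \{1, 2, 3, \dots\}$. For $a \in \mathbb{N}$, $a\mathbb{N} = \{an : n \in \mathbb{N}\}$. A partition of $n$ is a finite non-increasing sequence of positive integers (parts) summing to $n$; the multiplicity of a part is the number of times it occurs. For $\mathcal{A} \subseteq \mathbb{N}$, $P(\mathcal{A}; n)$ denotes the number of partitions of $n$ in which the multiplicity of every part (that occurs) belongs to $\mathcal{A}$. For $\mathcal{B} \subseteq \mathbb{N}$, $Q(\mathcal{B}; n)$ denotes the number of partitions of $n$ all of whose parts belong to $\mathcal{B}$. By convention $P(\mathcal{A}; 0) = Q(\mathcal{B}; 0) = 1$. -}

module Defs where

open import Data.Nat using (ℕ; zero; suc; _*_; _∸_; _≡ᵇ_; _≤_; _≥_; _≟_; _≤?_; _≥?_)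
open import Data.Nat.Divisibility using (_∣_; _∣?_)
open import Data.Integer using (ℤ; 0ℤ; 1ℤ) renaming (_+_ to _+ℤ_; _*_ to _*ℤ_; _-_ to _-ℤ_)
open import Data.Bool using (if_then_else_)
open import Data.List using (List; []; _∷_; length; filter; map; concatMap)
open import Data.Nat.ListAction using (sum)
open import Level using (0ℓ)
open import Data.List.Relation.Unary.All using (All; all?)
open import Data.List.Relation.Unary.Any using (Any; any?)
open import Data.List.Relation.Unary.Linked using (Linked; linked?)
open import Data.Product using (_×_)
open import Data.Empty using (⊥)
open import Relation.Nullary using (¬_; Dec; yes; no; ¬?; _×-dec_)
open import Relation.Unary using (Pred; Decidable)
open import Relation.Binary.PropositionalEquality using (_≡_)

data ℕ∞ : Set where
  fin : ℕ → ℕ∞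
  ∞   : ℕ∞

_·∞_ : ℕ → ℕ∞ → ℕ∞
b ·∞ fin d = fin (b * d)
b ·∞ ∞     = ∞

Series : Set
Series = ℕ → ℤ

sumTo : (ℕ → ℤ) → ℕ → ℤ
sumTo f zero    = 0ℤ
sumTo f (suc n) = sumTo f n +ℤ f n

_⊛_ : Series → Series → Series
(f ⊛ g) n = sumTo (λ i → f i *ℤ g (n ∸ i)) (suc n)

_⊖_ : Series → Series → Series
(f ⊖ g) n = f n -ℤ g n

𝟙 : Series
𝟙 n = if n ≡ᵇ 0 then 1ℤ else 0ℤ

X^ : ℕ∞ → Series
X^ (fin m) n = if n ≡ᵇ m then 1ℤ else 0ℤ
X^ ∞       n = 0ℤ

∏ : List ℕ → (ℕ → Series) → Series
∏ []       F = 𝟙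
∏ (b ∷ bs) F = F b ⊛ ∏ bs F

-- 1 + Σ_{a ∈ A} x^a   (A ⊆ ℕ = {1,2,...}; only positive a contribute)
oneplus : (A : Pred ℕ 0ℓ) → Decidable A → Series
oneplus A A? zero    = 1ℤ
oneplus A A? (suc n) = if Relation.Nullary.does (A? (suc n)) then 1ℤ else 0ℤ

InMultiples : ℕ∞ → ℕ → Set
InMultiples (fin c) k = (1 ≤ k) × (c ∣ k)
InMultiples ∞       k = ⊥

inMultiples? : (c : ℕ∞) → Decidable (InMultiples c)
inMultiples? (fin c) k = (1 ≤? k) ×-dec (c ∣? k)
inMultiples? ∞       k = no (λ ())

InS : (ℕ → ℕ∞) → ℕ → ℕ → Set
InS δ b k = InMultiples (fin b) k × ¬ InMultiples (b ·∞ δ b) k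

inS? : (δ : ℕ → ℕ∞) (b : ℕ) → Decidable (InS δ b)
inS? δ b k = inMultiples? (fin b) k ×-dec ¬? (inMultiples? (b ·∞ δ b) k)

In𝓑 : List ℕ → (ℕ → ℕ∞) → ℕ → Set
In𝓑 B δ k = Any (λ b → InS δ b k) B

in𝓑? : (B : List ℕ) (δ : ℕ → ℕ∞) → Decidable (In𝓑 B δ)
in𝓑? B δ k = any? (λ b → inS? δ b k) B

range1 : ℕ → List ℕ
range1 zero    = []
range1 (suc m) = range1 m Data.List.++ (suc m ∷ [])

lists : ℕ → ℕ → List (List ℕ)
lists zero    m = [] ∷ []
lists (suc k) m = [] ∷ concatMap (λ x → map (x ∷_) (lists k m)) (range1 m)

IsPartition : ℕ → List ℕ → Set
IsPartition n l = Linked _≥_ l × All (1 ≤_) l × (sum l ≡ n)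

isPartition? : (n : ℕ) → Decidable (IsPartition n)
isPartition? n l = linked? _≥?_ l ×-dec (all? (1 ≤?_) l ×-dec (sum l ≟ n))

-- every partition of n has at most n parts, each ≤ n
partitions : ℕ → List (List ℕ)
partitions n = filter (isPartition? n) (lists n n)

mult : ℕ → List ℕ → ℕ
mult x l = length (filter (x ≟_) l)

MultsIn : (𝒜 : Pred ℕ 0ℓ) → List ℕ → Set
MultsIn 𝒜 l = All (λ x → 𝒜 (mult x l)) l

P : (𝒜 : Pred ℕ 0ℓ) → Decidable 𝒜 → ℕ → ℕ
P 𝒜 𝒜? n = length (filter (λ l → all? (λ x → 𝒜? (mult x l)) l) (partitions n))

Q : (𝓑 : Pred ℕ 0ℓ) → Decidable 𝓑 → ℕ → ℕ
Q 𝓑 𝓑? n = length (filter (all? 𝓑?) (partitions n))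

-- Substituting x ↦ x^k in the identity and multiplying over k = 1, …, n turns
-- 1 + Σ_{a∈A} x^a into ∏_k (1 + Σ_{a∈A} x^{ka}), whose coefficient of x^n is P(A; n),
-- and turns the factor (1 − x^{bδ_b})/(1 − x^b) into ∏_k (1 − x^{kbδ_b})/(1 − x^{kb}),
-- which up to degree n is ∏ 1/(1 − x^m) over m ∈ bℕ ∖ bδ_bℕ. The sets bℕ ∖ bδ_bℕ are
-- pairwise disjoint, so the whole right-hand side becomes ∏_{m∈𝓑} 1/(1 − x^m), whose
-- coefficient of x^n is Q(𝓑; n). Both coefficients are identified with the counts by
-- enumerating partitions according to the multiplicity of their largest part.

module Submission where

open import Defs
open import Level using (0ℓ)
open import Function using (_∘_)
open import Data.Bool using (if_then_else_)
open import Data.Empty using (⊥-elim)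
open import Data.Sum using (_⊎_; inj₁; inj₂; [_,_]; swap; map₂)
open import Data.Product using (_×_; _,_; Σ; proj₁; proj₂)
open import Data.Nat using (ℕ; zero; suc; _+_; _*_; _∸_; _≤_; _<_; _≥_; z≤n; s≤s; _≤?_; _<?_; _≟_)
import Data.Nat.Properties as ℕₚ
open import Data.Nat.Divisibility
  using (_∣_; _∣?_; divides; quotient; ∣m+n∣m⇒∣n; ∣⇒≤; n∣m*n; m∣m*n; ∣m∸n∣n⇒∣m; ∣-trans; ∣-refl)
open import Data.Nat.ListAction using (sum)
open import Data.Nat.ListAction.Properties using (sum-++)
open import Data.Integer using (ℤ; 0ℤ; 1ℤ; +_)
  renaming (_+_ to _+ℤ_; _*_ to _*ℤ_; _-_ to _-ℤ_)
import Data.Integer.Properties as ℤₚ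
open import Data.Integer.Solver using (module +-*-Solver)
open +-*-Solver using (solve; _:=_; _:+_; _:*_; _:-_)
open import Data.List using (List; []; _∷_; _++_; length; filter; map; concatMap; replicate; cartesianProductWith)
import Data.List.Properties as Listₚ
open import Data.List.Membership.Propositional using (_∈_; find; _─_)
open import Data.List.Relation.Binary.Subset.Propositional using (_⊆_)
open import Data.List.Relation.Unary.Any using (here; there; index)
open import Data.List.Relation.Unary.All using (All; []; _∷_; all?)
import Data.List.Relation.Unary.All as All
import Data.List.Relation.Unary.All.Properties as Allₚ
open import Data.List.Relation.Unary.Linked using (Linked; []; [-]; _∷_)
import Data.List.Relation.Unary.Linked as Linked
open import Data.List.Relation.Binary.Disjoint.Propositional using (Disjoint)
open import Data.List.Relation.Unary.AllPairs using ([]; _∷_)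
open import Data.List.Relation.Unary.Unique.Propositional using (Unique)
import Data.List.Relation.Unary.Unique.Propositional.Properties as Uniqueₚ
open import Data.List.Membership.Propositional.Properties
  using (∈-filter⁺; ∈-filter⁻; ∈-map⁺; ∈-map⁻; ∈-++⁺ˡ; ∈-++⁺ʳ; ∈-++⁻; ∈-cartesianProductWith⁺; ∈-cartesianProductWith⁻)
open import Relation.Binary.Bundles using (Setoid)
open import Relation.Binary.PropositionalEquality
  using (_≡_; _≢_; _≗_; refl; sym; trans; cong; cong₂; subst; module ≡-Reasoning; _→-setoid_)
import Relation.Binary.Reasoning.Setoid as SetoidReasoning
open import Relation.Nullary using (¬_; Dec; yes; no; does)
open import Relation.Nullary.Decidable using (dec-true; dec-false; toSum)
open import Relation.Unary using (Pred; Decidable)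

-- Formal power series

infix 4 _≈[_]_

_≈[_]_ : Series → ℕ → Series → Set
f ≈[ M ] g = ∀ n → n ≤ M → f n ≡ g n

≈[]-setoid : ℕ → Setoid 0ℓ 0ℓ
≈[]-setoid M = record
  { Carrier = Series
  ; _≈_ = _≈[ M ]_
  ; isEquivalence = record
    { refl = λ _ _ → refl
    ; sym = λ e n n≤M → sym (e n n≤M)
    ; trans = λ e e′ n n≤M → trans (e n n≤M) (e′ n n≤M)
    }
  }

module ≗-Reasoning = SetoidReasoning (ℕ →-setoid ℤ)
module ≈[]-Reasoning (M : ℕ) = SetoidReasoning (≈[]-setoid M)

≗-refl : {f : Series} → f ≗ f
≗-refl n = refl

≗-sym : {f g : Series} → f ≗ g → g ≗ f
≗-sym e n = sym (e n)

≗⇒≈[] : {f g : Series} (M : ℕ) → f ≗ g → f ≈[ M ] g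
≗⇒≈[] M e n _ = e n

≈[]-refl : {f : Series} {M : ℕ} → f ≈[ M ] f
≈[]-refl n _ = refl

sumTo-cong : ∀ {f g} n → (∀ i → i < n → f i ≡ g i) → sumTo f n ≡ sumTo g n
sumTo-cong zero    e = refl
sumTo-cong (suc n) e = cong₂ _+ℤ_ (sumTo-cong n (λ i i<n → e i (ℕₚ.m<n⇒m<1+n i<n))) (e n ℕₚ.≤-refl)

sumTo-zero : ∀ {f} n → (∀ i → i < n → f i ≡ 0ℤ) → sumTo f n ≡ 0ℤ
sumTo-zero zero    e = refl
sumTo-zero (suc n) e = cong₂ _+ℤ_ (sumTo-zero n (λ i i<n → e i (ℕₚ.m<n⇒m<1+n i<n))) (e n ℕₚ.≤-refl)

private
  +-interchange : ∀ a b c d → (a +ℤ b) +ℤ (c +ℤ d) ≡ (a +ℤ c) +ℤ (b +ℤ d)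
  +-interchange = solve 4 (λ a b c d → (a :+ b) :+ (c :+ d) := (a :+ c) :+ (b :+ d)) refl

  minus-interchange : ∀ a b c d → (a -ℤ b) +ℤ (c -ℤ d) ≡ (a +ℤ c) -ℤ (b +ℤ d)
  minus-interchange = solve 4 (λ a b c d → (a :- b) :+ (c :- d) := (a :+ c) :- (b :+ d)) refl

  *-distribˡ-minus : ∀ a b c → a *ℤ (b -ℤ c) ≡ a *ℤ b -ℤ a *ℤ c
  *-distribˡ-minus = solve 3 (λ a b c → a :* (b :- c) := a :* b :- a :* c) refl

sumTo-+ : ∀ f g n → sumTo (λ i → f i +ℤ g i) n ≡ sumTo f n +ℤ sumTo g n
sumTo-+ f g zero    = refl
sumTo-+ f g (suc n) =
  trans (cong (_+ℤ (f n +ℤ g n)) (sumTo-+ f g n)) (+-interchange (sumTo f n) (sumTo g n) (f n) (g n))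

sumTo-minus : ∀ f g n → sumTo (λ i → f i -ℤ g i) n ≡ sumTo f n -ℤ sumTo g n
sumTo-minus f g zero    = refl
sumTo-minus f g (suc n) =
  trans (cong (_+ℤ (f n -ℤ g n)) (sumTo-minus f g n)) (minus-interchange (sumTo f n) (sumTo g n) (f n) (g n))

sumTo-*ˡ : ∀ c f n → sumTo (λ i → c *ℤ f i) n ≡ c *ℤ sumTo f n
sumTo-*ˡ c f zero    = sym (ℤₚ.*-zeroʳ c)
sumTo-*ˡ c f (suc n) =
  trans (cong (_+ℤ c *ℤ f n) (sumTo-*ˡ c f n)) (sym (ℤₚ.*-distribˡ-+ c (sumTo f n) (f n)))

sumTo-*ʳ : ∀ c f n → sumTo (λ i → f i *ℤ c) n ≡ sumTo f n *ℤ c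
sumTo-*ʳ c f zero    = sym (ℤₚ.*-zeroˡ c)
sumTo-*ʳ c f (suc n) =
  trans (cong (_+ℤ f n *ℤ c) (sumTo-*ʳ c f n)) (sym (ℤₚ.*-distribʳ-+ c (sumTo f n) (f n)))

sumTo-split : ∀ f m r → sumTo f (m + r) ≡ sumTo f m +ℤ sumTo (λ i → f (m + i)) r
sumTo-split f m zero    rewrite ℕₚ.+-identityʳ m = sym (ℤₚ.+-identityʳ _)
sumTo-split f m (suc r) rewrite ℕₚ.+-suc m r =
  trans (cong (_+ℤ f (m + r)) (sumTo-split f m r))
        (ℤₚ.+-assoc (sumTo f m) (sumTo (λ i → f (m + i)) r) (f (m + r)))

sumTo-head : ∀ f n → sumTo f (suc n) ≡ f 0 +ℤ sumTo (λ i → f (suc i)) n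
sumTo-head f n = trans (sumTo-split f 1 n) (cong (_+ℤ sumTo (λ i → f (suc i)) n) (ℤₚ.+-identityˡ (f 0)))

sumTo-reverse : ∀ f n → sumTo f n ≡ sumTo (λ i → f (n ∸ suc i)) n
sumTo-reverse f zero    = refl
sumTo-reverse f (suc n) =
  trans (cong (_+ℤ f n) (sumTo-reverse f n))
        (trans (ℤₚ.+-comm (sumTo (λ i → f (n ∸ suc i)) n) (f n))
               (sym (sumTo-head (λ i → f (suc n ∸ suc i)) n)))

sumTo-extend : ∀ f a b → a ≤ b → (∀ i → a ≤ i → f i ≡ 0ℤ) → sumTo f b ≡ sumTo f a
sumTo-extend f a b a≤b f≡0 = begin
  sumTo f b                                   ≡⟨ cong (sumTo f) (sym (ℕₚ.m+[n∸m]≡n a≤b)) ⟩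
  sumTo f (a + (b ∸ a))                       ≡⟨ sumTo-split f a (b ∸ a) ⟩
  sumTo f a +ℤ sumTo (λ i → f (a + i)) (b ∸ a) ≡⟨ cong (sumTo f a +ℤ_) (sumTo-zero (b ∸ a) (λ i _ → f≡0 (a + i) (ℕₚ.m≤m+n a i))) ⟩
  sumTo f a +ℤ 0ℤ                             ≡⟨ ℤₚ.+-identityʳ (sumTo f a) ⟩
  sumTo f a                                   ∎
  where open ≡-Reasoning

sumTo-triangle : ∀ (F : ℕ → ℕ → ℤ) N →
  sumTo (λ i → sumTo (F i) (suc i)) N ≡ sumTo (λ j → sumTo (λ l → F (j + l) j) (N ∸ j)) N
sumTo-triangle F zero    = refl
sumTo-triangle F (suc N) = sym (begin
  sumTo (λ j → sumTo (λ l → F (j + l) j) (suc N ∸ j)) N +ℤ sumTo (λ l → F (N + l) N) (suc N ∸ N)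
    ≡⟨ cong₂ _+ℤ_ (sumTo-cong N lastRow) (cong (sumTo (λ l → F (N + l) N)) (ℕₚ.m+n∸n≡m 1 N)) ⟩
  sumTo (λ j → sumTo (λ l → F (j + l) j) (N ∸ j) +ℤ F N j) N +ℤ (0ℤ +ℤ F (N + 0) N)
    ≡⟨ cong₂ _+ℤ_ (sumTo-+ _ (F N) N) (trans (ℤₚ.+-identityˡ _) (cong (λ x → F x N) (ℕₚ.+-identityʳ N))) ⟩
  (sumTo (λ j → sumTo (λ l → F (j + l) j) (N ∸ j)) N +ℤ sumTo (F N) N) +ℤ F N N
    ≡⟨ ℤₚ.+-assoc (sumTo (λ j → sumTo (λ l → F (j + l) j) (N ∸ j)) N) (sumTo (F N) N) (F N N) ⟩
  sumTo (λ j → sumTo (λ l → F (j + l) j) (N ∸ j)) N +ℤ sumTo (F N) (suc N)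
    ≡⟨ cong (_+ℤ sumTo (F N) (suc N)) (sym (sumTo-triangle F N)) ⟩
  sumTo (λ i → sumTo (F i) (suc i)) N +ℤ sumTo (F N) (suc N) ∎)
  where
  open ≡-Reasoning
  lastRow : ∀ j → j < N →
    sumTo (λ l → F (j + l) j) (suc N ∸ j) ≡ sumTo (λ l → F (j + l) j) (N ∸ j) +ℤ F N j
  lastRow j j<N rewrite ℕₚ.+-∸-assoc 1 (ℕₚ.<⇒≤ j<N) =
    cong (λ x → sumTo (λ l → F (j + l) j) (N ∸ j) +ℤ F x j) (ℕₚ.m+[n∸m]≡n (ℕₚ.<⇒≤ j<N))

⊛-cong-≈[] : ∀ {f f′ g g′ M} → f ≈[ M ] f′ → g ≈[ M ] g′ → (f ⊛ g) ≈[ M ] (f′ ⊛ g′)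
⊛-cong-≈[] f≈f′ g≈g′ n n≤M = sumTo-cong (suc n) λ i i≤n →
  cong₂ _*ℤ_ (f≈f′ i (ℕₚ.≤-trans (ℕₚ.≤-pred i≤n) n≤M)) (g≈g′ _ (ℕₚ.≤-trans (ℕₚ.m∸n≤m n i) n≤M))

⊛-congˡ-≈[] : ∀ {f f′ M} g → f ≈[ M ] f′ → (f ⊛ g) ≈[ M ] (f′ ⊛ g)
⊛-congˡ-≈[] g f≈f′ = ⊛-cong-≈[] f≈f′ (≈[]-refl {g})

⊛-congʳ-≈[] : ∀ f {g g′ M} → g ≈[ M ] g′ → (f ⊛ g) ≈[ M ] (f ⊛ g′)
⊛-congʳ-≈[] f g≈g′ = ⊛-cong-≈[] (≈[]-refl {f}) g≈g′

⊛-cong : ∀ {f f′ g g′} → f ≗ f′ → g ≗ g′ → (f ⊛ g) ≗ (f′ ⊛ g′)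
⊛-cong f≗f′ g≗g′ n = ⊛-cong-≈[] (≗⇒≈[] n f≗f′) (≗⇒≈[] n g≗g′) n ℕₚ.≤-refl

⊛-congˡ : ∀ {f f′} g → f ≗ f′ → (f ⊛ g) ≗ (f′ ⊛ g)
⊛-congˡ g f≗f′ = ⊛-cong f≗f′ (≗-refl {g})

⊛-congʳ : ∀ f {g g′} → g ≗ g′ → (f ⊛ g) ≗ (f ⊛ g′)
⊛-congʳ f g≗g′ = ⊛-cong (≗-refl {f}) g≗g′

⊛-comm : ∀ f g → (f ⊛ g) ≗ (g ⊛ f)
⊛-comm f g n = trans (sumTo-reverse _ (suc n)) (sumTo-cong (suc n) λ i i≤n →
  trans (ℤₚ.*-comm (f (n ∸ i)) (g (n ∸ (n ∸ i))))
        (cong (λ x → g x *ℤ f (n ∸ i)) (ℕₚ.m∸[m∸n]≡n (ℕₚ.≤-pred i≤n))))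

⊛-identityˡ : ∀ f → (𝟙 ⊛ f) ≗ f
⊛-identityˡ f n = trans (sumTo-head _ n)
  (trans (cong₂ _+ℤ_ (ℤₚ.*-identityˡ (f n)) (sumTo-zero n (λ i _ → ℤₚ.*-zeroˡ (f (n ∸ suc i)))))
         (ℤₚ.+-identityʳ (f n)))

⊛-identityʳ : ∀ f → (f ⊛ 𝟙) ≗ f
⊛-identityʳ f n = trans (⊛-comm f 𝟙 n) (⊛-identityˡ f n)

⊛-assoc : ∀ f g h → ((f ⊛ g) ⊛ h) ≗ (f ⊛ (g ⊛ h))
⊛-assoc f g h n = begin
  sumTo (λ i → sumTo (λ j → f j *ℤ g (i ∸ j)) (suc i) *ℤ h (n ∸ i)) (suc n)
    ≡⟨ sumTo-cong (suc n) (λ i _ → sym (sumTo-*ʳ (h (n ∸ i)) _ (suc i))) ⟩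
  sumTo (λ i → sumTo (λ j → f j *ℤ g (i ∸ j) *ℤ h (n ∸ i)) (suc i)) (suc n)
    ≡⟨ sumTo-triangle (λ i j → f j *ℤ g (i ∸ j) *ℤ h (n ∸ i)) (suc n) ⟩
  sumTo (λ j → sumTo (λ l → f j *ℤ g (j + l ∸ j) *ℤ h (n ∸ (j + l))) (suc n ∸ j)) (suc n)
    ≡⟨ sumTo-cong (suc n) (λ j j≤n → inner j (ℕₚ.≤-pred j≤n)) ⟩
  sumTo (λ j → f j *ℤ sumTo (λ l → g l *ℤ h (n ∸ j ∸ l)) (suc (n ∸ j))) (suc n) ∎
  where
  open ≡-Reasoning
  inner : ∀ j → j ≤ n → sumTo (λ l → f j *ℤ g (j + l ∸ j) *ℤ h (n ∸ (j + l))) (suc n ∸ j)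
                      ≡ f j *ℤ sumTo (λ l → g l *ℤ h (n ∸ j ∸ l)) (suc (n ∸ j))
  inner j j≤n rewrite ℕₚ.+-∸-assoc 1 j≤n = trans
    (sumTo-cong (suc (n ∸ j)) (λ l _ → trans (ℤₚ.*-assoc (f j) (g (j + l ∸ j)) (h (n ∸ (j + l))))
      (cong₂ (λ a b → f j *ℤ (g a *ℤ h b)) (ℕₚ.m+n∸m≡n j l) (sym (ℕₚ.∸-+-assoc n j l)))))
    (sumTo-*ˡ (f j) _ (suc (n ∸ j)))

⊛-interchange : ∀ a b c d → ((a ⊛ b) ⊛ (c ⊛ d)) ≗ ((a ⊛ c) ⊛ (b ⊛ d))
⊛-interchange a b c d = begin
  (a ⊛ b) ⊛ (c ⊛ d)  ≈⟨ ⊛-assoc a b (c ⊛ d) ⟩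
  a ⊛ (b ⊛ (c ⊛ d))  ≈⟨ ⊛-congʳ a (≗-sym (⊛-assoc b c d)) ⟩
  a ⊛ ((b ⊛ c) ⊛ d)  ≈⟨ ⊛-congʳ a (⊛-congˡ d (⊛-comm b c)) ⟩
  a ⊛ ((c ⊛ b) ⊛ d)  ≈⟨ ⊛-congʳ a (⊛-assoc c b d) ⟩
  a ⊛ (c ⊛ (b ⊛ d))  ≈⟨ ⊛-assoc a c (b ⊛ d) ⟨
  (a ⊛ c) ⊛ (b ⊛ d)  ∎
  where open ≗-Reasoning

⊛-distribˡ-⊖ : ∀ f g h → (f ⊛ (g ⊖ h)) ≗ ((f ⊛ g) ⊖ (f ⊛ h))
⊛-distribˡ-⊖ f g h n =
  trans (sumTo-cong (suc n) (λ i _ → *-distribˡ-minus (f i) (g (n ∸ i)) (h (n ∸ i)))) (sumTo-minus _ _ (suc n))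

when : {P : Set} → Dec P → ℤ → ℤ
when (yes _) x = x
when (no _)  _ = 0ℤ

when-yes : ∀ {P : Set} (d : Dec P) x → P → when d x ≡ x
when-yes (yes _) x _ = refl
when-yes (no ¬p) x p = ⊥-elim (¬p p)

when-no : ∀ {P : Set} (d : Dec P) x → ¬ P → when d x ≡ 0ℤ
when-no (yes p) x ¬p = ⊥-elim (¬p p)
when-no (no _)  x _  = refl

when-0 : ∀ {P : Set} (d : Dec P) → when d 0ℤ ≡ 0ℤ
when-0 (yes _) = refl
when-0 (no _)  = refl

-- Dilations and products

dilate : ℕ → Series → Series
dilate k f n with k ∣? n
... | yes k∣n = f (quotient k∣n)
... | no _    = 0ℤ

dilate-multiple : ∀ k f j → dilate (suc k) f (j * suc k) ≡ f j
dilate-multiple k f j with suc k ∣? (j * suc k)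
... | yes (divides q eq) = cong f (ℕₚ.*-cancelʳ-≡ q j (suc k) (sym eq))
... | no k∤jk            = ⊥-elim (k∤jk (n∣m*n j))

dilate-nonmultiple : ∀ k f n → ¬ k ∣ n → dilate k f n ≡ 0ℤ
dilate-nonmultiple k f n k∤n with k ∣? n
... | yes k∣n = ⊥-elim (k∤n k∣n)
... | no _    = refl

dilate-cong : ∀ k {f g} → f ≗ g → dilate k f ≗ dilate k g
dilate-cong k f≗g n with k ∣? n
... | yes k∣n = f≗g (quotient k∣n)
... | no _    = refl

data DivView (k n : ℕ) : Set where
  multiple    : ∀ q → n ≡ q * suc k → DivView k n
  nonmultiple : ¬ suc k ∣ n → DivView k n

divView : ∀ k n → DivView k n
divView k n with suc k ∣? n
... | yes (divides q eq) = multiple q eq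
... | no k∤n             = nonmultiple k∤n

dilate-𝟙 : ∀ k → dilate (suc k) 𝟙 ≗ 𝟙
dilate-𝟙 k n with divView k n
... | multiple zero    refl = dilate-multiple k 𝟙 0
... | multiple (suc q) refl = dilate-multiple k 𝟙 (suc q)
dilate-𝟙 k zero    | nonmultiple k∤0 = ⊥-elim (k∤0 (divides 0 refl))
dilate-𝟙 k (suc n) | nonmultiple k∤n = dilate-nonmultiple (suc k) 𝟙 (suc n) k∤n

sumTo-multiples : ∀ k f → (∀ i → ¬ suc k ∣ i → f i ≡ 0ℤ) →
  ∀ J → sumTo f (J * suc k) ≡ sumTo (λ j → f (j * suc k)) J
sumTo-multiples k f f≡0 zero    = refl
sumTo-multiples k f f≡0 (suc J) = begin
  sumTo f (suc k + J * suc k)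
    ≡⟨ cong (sumTo f) (ℕₚ.+-comm (suc k) (J * suc k)) ⟩
  sumTo f (J * suc k + suc k)
    ≡⟨ sumTo-split f (J * suc k) (suc k) ⟩
  sumTo f (J * suc k) +ℤ sumTo (λ i → f (J * suc k + i)) (suc k)
    ≡⟨ cong₂ _+ℤ_ (sumTo-multiples k f f≡0 J) (sumTo-head (λ i → f (J * suc k + i)) k) ⟩
  S +ℤ (f (J * suc k + 0) +ℤ sumTo (λ i → f (J * suc k + suc i)) k)
    ≡⟨ cong₂ (λ x y → S +ℤ (f x +ℤ y)) (ℕₚ.+-identityʳ (J * suc k)) (sumTo-zero k gap) ⟩
  S +ℤ (f (J * suc k) +ℤ 0ℤ)
    ≡⟨ cong (S +ℤ_) (ℤₚ.+-identityʳ (f (J * suc k))) ⟩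
  sumTo (λ j → f (j * suc k)) (suc J) ∎
  where
  open ≡-Reasoning
  S : ℤ
  S = sumTo (λ j → f (j * suc k)) J
  gap : ∀ r → r < k → f (J * suc k + suc r) ≡ 0ℤ
  gap r r<k = f≡0 _ (λ k∣ → ℕₚ.<⇒≱ (s≤s r<k) (∣⇒≤ (∣m+n∣m⇒∣n k∣ (n∣m*n J))))

dilate-⊛-expand : ∀ k f g n →
  (dilate (suc k) f ⊛ g) n ≡ sumTo (λ j → when (j * suc k ≤? n) (f j *ℤ g (n ∸ j * suc k))) (suc n)
dilate-⊛-expand k f g n = begin
  sumTo (λ i → dilate (suc k) f i *ℤ g (n ∸ i)) (suc n)
    ≡⟨ sumTo-cong (suc n) (λ i i≤n → sym (when-yes (i ≤? n) _ (ℕₚ.≤-pred i≤n))) ⟩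
  sumTo term (suc n)
    ≡⟨ sumTo-extend term (suc n) (suc n * suc k) (ℕₚ.m≤m*n (suc n) (suc k)) (λ i n<i → when-no (i ≤? n) _ (ℕₚ.<⇒≱ n<i)) ⟨
  sumTo term (suc n * suc k)
    ≡⟨ sumTo-multiples k term offMultiples (suc n) ⟩
  sumTo (λ j → term (j * suc k)) (suc n)
    ≡⟨ sumTo-cong (suc n) (λ j _ → cong (λ x → when (j * suc k ≤? n) (x *ℤ g (n ∸ j * suc k))) (dilate-multiple k f j)) ⟩
  sumTo (λ j → when (j * suc k ≤? n) (f j *ℤ g (n ∸ j * suc k))) (suc n) ∎
  where
  open ≡-Reasoning
  term : ℕ → ℤ
  term i = when (i ≤? n) (dilate (suc k) f i *ℤ g (n ∸ i))
  offMultiples : ∀ i → ¬ suc k ∣ i → term i ≡ 0ℤ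
  offMultiples i k∤i = trans (cong (when (i ≤? n))
    (trans (cong (_*ℤ g (n ∸ i)) (dilate-nonmultiple (suc k) f i k∤i)) (ℤₚ.*-zeroˡ (g (n ∸ i))))) (when-0 (i ≤? n))

dilate-⊛-nonmultiple : ∀ k f g n → ¬ suc k ∣ n → (dilate (suc k) f ⊛ dilate (suc k) g) n ≡ 0ℤ
dilate-⊛-nonmultiple k f g n k∤n =
  trans (dilate-⊛-expand k f (dilate (suc k) g) n) (sumTo-zero (suc n) (λ j _ → vanish j (j * suc k ≤? n)))
  where
  vanish : ∀ j (d : Dec (j * suc k ≤ n)) → when d (f j *ℤ dilate (suc k) g (n ∸ j * suc k)) ≡ 0ℤ
  vanish j (no _)   = refl
  vanish j (yes le) = trans (cong (f j *ℤ_) (dilate-nonmultiple (suc k) g _ (λ k∣ → k∤n (∣m∸n∣n⇒∣m (suc k) le k∣ (n∣m*n j)))))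
                            (ℤₚ.*-zeroʳ (f j))

dilate-⊛-multiple : ∀ k f g m → (dilate (suc k) f ⊛ dilate (suc k) g) (m * suc k) ≡ (f ⊛ g) m
dilate-⊛-multiple k f g m = begin
  (dilate (suc k) f ⊛ dilate (suc k) g) (m * suc k)
    ≡⟨ dilate-⊛-expand k f (dilate (suc k) g) (m * suc k) ⟩
  sumTo (λ j → when (j * suc k ≤? m * suc k) (f j *ℤ dilate (suc k) g (m * suc k ∸ j * suc k))) (suc (m * suc k))
    ≡⟨ sumTo-cong (suc (m * suc k)) (λ j _ → rescale j (j ≤? m)) ⟩
  sumTo term (suc (m * suc k))
    ≡⟨ sumTo-extend term (suc m) (suc (m * suc k)) (s≤s (ℕₚ.m≤m*n m (suc k))) (λ i m<i → when-no (i ≤? m) _ (ℕₚ.<⇒≱ m<i)) ⟩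
  sumTo term (suc m)
    ≡⟨ sumTo-cong (suc m) (λ j j≤m → when-yes (j ≤? m) _ (ℕₚ.≤-pred j≤m)) ⟩
  (f ⊛ g) m ∎
  where
  open ≡-Reasoning
  term : ℕ → ℤ
  term j = when (j ≤? m) (f j *ℤ g (m ∸ j))
  rescale : ∀ j → Dec (j ≤ m) →
    when (j * suc k ≤? m * suc k) (f j *ℤ dilate (suc k) g (m * suc k ∸ j * suc k)) ≡ term j
  rescale j (yes j≤m) = begin
    when (j * suc k ≤? m * suc k) (f j *ℤ dilate (suc k) g (m * suc k ∸ j * suc k))
      ≡⟨ when-yes (j * suc k ≤? m * suc k) _ (ℕₚ.*-monoˡ-≤ (suc k) j≤m) ⟩
    f j *ℤ dilate (suc k) g (m * suc k ∸ j * suc k)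
      ≡⟨ cong (λ x → f j *ℤ dilate (suc k) g x) (ℕₚ.*-distribʳ-∸ (suc k) m j) ⟨
    f j *ℤ dilate (suc k) g ((m ∸ j) * suc k)
      ≡⟨ cong (f j *ℤ_) (dilate-multiple k g (m ∸ j)) ⟩
    f j *ℤ g (m ∸ j)
      ≡⟨ when-yes (j ≤? m) _ j≤m ⟨
    term j ∎
  rescale j (no j≰m) = trans (when-no (j * suc k ≤? m * suc k) _ (λ le → j≰m (ℕₚ.*-cancelʳ-≤ j m (suc k) le)))
                             (sym (when-no (j ≤? m) _ j≰m))

dilate-⊛ : ∀ k f g → dilate (suc k) (f ⊛ g) ≗ (dilate (suc k) f ⊛ dilate (suc k) g)
dilate-⊛ k f g n with divView k n
... | nonmultiple k∤n = trans (dilate-nonmultiple (suc k) (f ⊛ g) n k∤n) (sym (dilate-⊛-nonmultiple k f g n k∤n))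
... | multiple m refl = trans (dilate-multiple k (f ⊛ g) m) (sym (dilate-⊛-multiple k f g m))

∏≤ : (ℕ → Series) → ℕ → Series
∏≤ F zero    = 𝟙
∏≤ F (suc M) = F (suc M) ⊛ ∏≤ F M

∏≤-cong-≈[] : ∀ {F G N} M → (∀ k → k < M → F (suc k) ≈[ N ] G (suc k)) → ∏≤ F M ≈[ N ] ∏≤ G M
∏≤-cong-≈[] zero    F≈G = ≈[]-refl
∏≤-cong-≈[] (suc M) F≈G = ⊛-cong-≈[] (F≈G M ℕₚ.≤-refl) (∏≤-cong-≈[] M (λ k k<M → F≈G k (ℕₚ.m<n⇒m<1+n k<M)))

∏≤-cong : ∀ {F G} M → (∀ k → k < M → F (suc k) ≗ G (suc k)) → ∏≤ F M ≗ ∏≤ G M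
∏≤-cong M F≗G n = ∏≤-cong-≈[] M (λ k k<M → ≗⇒≈[] n (F≗G k k<M)) n ℕₚ.≤-refl

∏≤-⊛ : ∀ F G M → ∏≤ (λ k → F k ⊛ G k) M ≗ (∏≤ F M ⊛ ∏≤ G M)
∏≤-⊛ F G zero    = ≗-sym (⊛-identityˡ 𝟙)
∏≤-⊛ F G (suc M) n = trans (⊛-congʳ (F (suc M) ⊛ G (suc M)) (∏≤-⊛ F G M) n)
                           (⊛-interchange (F (suc M)) (G (suc M)) (∏≤ F M) (∏≤ G M) n)

∏≤-𝟙 : ∀ F M → (∀ k → k < M → F (suc k) ≗ 𝟙) → ∏≤ F M ≗ 𝟙
∏≤-𝟙 F zero    F≗𝟙 = ≗-refl
∏≤-𝟙 F (suc M) F≗𝟙 n =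
  trans (⊛-cong (F≗𝟙 M ℕₚ.≤-refl) (∏≤-𝟙 F M (λ k k<M → F≗𝟙 k (ℕₚ.m<n⇒m<1+n k<M))) n) (⊛-identityˡ 𝟙 n)

∏≤-extend : ∀ F N K → (∀ k → K ≤ k → F (suc k) ≈[ N ] 𝟙) → ∀ L → ∏≤ F (L + K) ≈[ N ] ∏≤ F K
∏≤-extend F N K F≈𝟙 zero    = ≈[]-refl
∏≤-extend F N K F≈𝟙 (suc L) n n≤N =
  trans (⊛-cong-≈[] (F≈𝟙 (L + K) (ℕₚ.m≤n+m K L)) (∏≤-extend F N K F≈𝟙 L) n n≤N) (⊛-identityˡ (∏≤ F K) n)

∏-cong-≈[] : ∀ {F G N} B → (∀ b → b ∈ B → F b ≈[ N ] G b) → ∏ B F ≈[ N ] ∏ B G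
∏-cong-≈[] []      F≈G = ≈[]-refl
∏-cong-≈[] (b ∷ B) F≈G = ⊛-cong-≈[] (F≈G b (here refl)) (∏-cong-≈[] B (λ b′ b′∈B → F≈G b′ (there b′∈B)))

∏-⊛ : ∀ F G B → ∏ B (λ b → F b ⊛ G b) ≗ (∏ B F ⊛ ∏ B G)
∏-⊛ F G []      = ≗-sym (⊛-identityˡ 𝟙)
∏-⊛ F G (b ∷ B) n = trans (⊛-congʳ (F b ⊛ G b) (∏-⊛ F G B) n) (⊛-interchange (F b) (G b) (∏ B F) (∏ B G) n)

∏-𝟙 : ∀ F B → (∀ b → b ∈ B → F b ≗ 𝟙) → ∏ B F ≗ 𝟙
∏-𝟙 F []      F≗𝟙 = ≗-refl
∏-𝟙 F (b ∷ B) F≗𝟙 n =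
  trans (⊛-cong (F≗𝟙 b (here refl)) (∏-𝟙 F B (λ b′ b′∈B → F≗𝟙 b′ (there b′∈B))) n) (⊛-identityˡ 𝟙 n)

dilations : ℕ → Series → Series
dilations M f = ∏≤ (λ k → dilate k f) M

dilations-cong : ∀ M {f g} → f ≗ g → dilations M f ≗ dilations M g
dilations-cong M f≗g = ∏≤-cong M (λ k _ → dilate-cong (suc k) f≗g)

dilations-⊛ : ∀ M f g → dilations M (f ⊛ g) ≗ (dilations M f ⊛ dilations M g)
dilations-⊛ M f g n =
  trans (∏≤-cong M (λ k _ → dilate-⊛ k f g) n) (∏≤-⊛ (λ k → dilate k f) (λ k → dilate k g) M n)

dilations-𝟙 : ∀ M → dilations M 𝟙 ≗ 𝟙
dilations-𝟙 M = ∏≤-𝟙 (λ k → dilate k 𝟙) M (λ k _ → dilate-𝟙 k)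

dilations-∏ : ∀ M F B → dilations M (∏ B F) ≗ ∏ B (λ b → dilations M (F b))
dilations-∏ M F []      = dilations-𝟙 M
dilations-∏ M F (b ∷ B) n =
  trans (dilations-⊛ M (F b) (∏ B F) n) (⊛-congʳ (dilations M (F b)) (dilations-∏ M F B) n)

allOnes : Series
allOnes _ = 1ℤ

geometric : ℕ → Series
geometric c = dilate c allOnes

geometric-∣ : ∀ c n → suc c ∣ n → geometric (suc c) n ≡ 1ℤ
geometric-∣ c n (divides q refl) = dilate-multiple c allOnes q

geometric-∤ : ∀ c n → ¬ suc c ∣ n → geometric (suc c) n ≡ 0ℤ
geometric-∤ c n = dilate-nonmultiple (suc c) allOnes n

geometric-shift : ∀ c n → suc c ≤ n → geometric (suc c) n ≡ geometric (suc c) (n ∸ suc c)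
geometric-shift c n c<n = shift (suc c ∣? (n ∸ suc c))
  where
  shift : Dec (suc c ∣ n ∸ suc c) → geometric (suc c) n ≡ geometric (suc c) (n ∸ suc c)
  shift (yes c∣n∸c) = trans (geometric-∣ c n (∣m∸n∣n⇒∣m (suc c) c<n c∣n∸c ∣-refl)) (sym (geometric-∣ c _ c∣n∸c))
  shift (no c∤n∸c)  = trans (geometric-∤ c n c∤n) (sym (geometric-∤ c _ c∤n∸c))
    where
    c∤n : ¬ suc c ∣ n
    c∤n c∣n = c∤n∸c (∣m+n∣m⇒∣n (subst (suc c ∣_) (sym (ℕₚ.m+[n∸m]≡n c<n)) c∣n) ∣-refl)

geometric-≈[]𝟙 : ∀ c N → N < suc c → geometric (suc c) ≈[ N ] 𝟙
geometric-≈[]𝟙 c N N≤c zero    _   = geometric-∣ c 0 (divides 0 refl)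
geometric-≈[]𝟙 c N N≤c (suc n) n<N = geometric-∤ c (suc n) (λ c∣ → ℕₚ.<⇒≱ (ℕₚ.≤-<-trans n<N N≤c) (∣⇒≤ c∣))

dilate-geometric : ∀ k b → dilate (suc k) (geometric (suc b)) ≗ geometric (suc k * suc b)
dilate-geometric k b n with divView k n
... | nonmultiple k∤n = trans (dilate-nonmultiple (suc k) _ n k∤n)
                              (sym (geometric-∤ _ n (λ kb∣n → k∤n (∣-trans (m∣m*n (suc b)) kb∣n))))
... | multiple q refl with suc b ∣? q
...   | yes (divides r refl) = trans (dilate-multiple k _ (r * suc b)) (trans (dilate-multiple b allOnes r)
          (sym (geometric-∣ _ _ (divides r (trans (ℕₚ.*-assoc r (suc b) (suc k)) (cong (r *_) (ℕₚ.*-comm (suc b) (suc k))))))))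
...   | no b∤q = trans (dilate-multiple k _ q) (trans (geometric-∤ b q b∤q) (sym (geometric-∤ _ _ kb∤qk)))
  where
  kb∤qk : ¬ suc k * suc b ∣ q * suc k
  kb∤qk (divides r eq) = b∤q (divides r (ℕₚ.*-cancelʳ-≡ q (r * suc b) (suc k)
    (trans eq (trans (cong (r *_) (ℕₚ.*-comm (suc k) (suc b))) (sym (ℕₚ.*-assoc r (suc b) (suc k)))))))

X^-at : ∀ c → X^ (fin c) c ≡ 1ℤ
X^-at zero    = refl
X^-at (suc c) = X^-at c

X^-off : ∀ c n → n ≢ c → X^ (fin c) n ≡ 0ℤ
X^-off zero    zero    n≢c = ⊥-elim (n≢c refl)
X^-off zero    (suc n) n≢c = refl
X^-off (suc c) zero    n≢c = refl
X^-off (suc c) (suc n) n≢c = X^-off c n (λ n≡c → n≢c (cong suc n≡c))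

sumTo-X^ : ∀ c (h : ℕ → ℤ) N → sumTo (λ i → X^ (fin c) i *ℤ h i) N ≡ when (c <? N) (h c)
sumTo-X^ c h zero    = refl
sumTo-X^ c h (suc N) with N ≟ c
... | yes refl = begin
  sumTo (λ i → X^ (fin c) i *ℤ h i) c +ℤ X^ (fin c) c *ℤ h c
    ≡⟨ cong₂ _+ℤ_ (trans (sumTo-X^ c h c) (when-no (c <? c) (h c) (ℕₚ.n≮n c)))
                  (trans (cong (_*ℤ h c) (X^-at c)) (ℤₚ.*-identityˡ (h c))) ⟩
  0ℤ +ℤ h c
    ≡⟨ ℤₚ.+-identityˡ (h c) ⟩
  h c
    ≡⟨ when-yes (c <? suc c) (h c) ℕₚ.≤-refl ⟨
  when (c <? suc c) (h c) ∎
  where open ≡-Reasoning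
... | no N≢c = begin
  sumTo (λ i → X^ (fin c) i *ℤ h i) N +ℤ X^ (fin c) N *ℤ h N
    ≡⟨ cong₂ _+ℤ_ (sumTo-X^ c h N) (trans (cong (_*ℤ h N) (X^-off c N N≢c)) (ℤₚ.*-zeroˡ (h N))) ⟩
  when (c <? N) (h c) +ℤ 0ℤ
    ≡⟨ ℤₚ.+-identityʳ _ ⟩
  when (c <? N) (h c)
    ≡⟨ step (c <? N) ⟩
  when (c <? suc N) (h c) ∎
  where
  open ≡-Reasoning
  step : Dec (c < N) → when (c <? N) (h c) ≡ when (c <? suc N) (h c)
  step (yes c<N) = trans (when-yes (c <? N) _ c<N) (sym (when-yes (c <? suc N) _ (ℕₚ.m<n⇒m<1+n c<N)))
  step (no c≮N)  = trans (when-no (c <? N) _ c≮N)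
    (sym (when-no (c <? suc N) _ (λ c<1+N → c≮N (ℕₚ.≤∧≢⇒< (ℕₚ.≤-pred c<1+N) (λ c≡N → N≢c (sym c≡N))))))

⊛-X^ : ∀ f c n → (f ⊛ X^ (fin c)) n ≡ when (c <? suc n) (f (n ∸ c))
⊛-X^ f c n = trans (⊛-comm f (X^ (fin c)) n) (sumTo-X^ c (λ i → f (n ∸ i)) (suc n))

geometric-inverse : ∀ c → (geometric (suc c) ⊛ (𝟙 ⊖ X^ (fin (suc c)))) ≗ 𝟙
geometric-inverse c n =
  trans (⊛-distribˡ-⊖ (geometric C) 𝟙 (X^ (fin C)) n)
        (trans (cong₂ _-ℤ_ (⊛-identityʳ (geometric C) n) (⊛-X^ (geometric C) C n)) (telescope n))
  where
  C : ℕ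
  C = suc c
  telescope : ∀ n → geometric C n -ℤ when (C <? suc n) (geometric C (n ∸ C)) ≡ 𝟙 n
  telescope zero    = cong (_-ℤ 0ℤ) (geometric-∣ c 0 (divides 0 refl))
  telescope (suc n) with C ≤? suc n
  ... | yes C≤n = trans (cong₂ _-ℤ_ (geometric-shift c (suc n) C≤n) (when-yes (C <? suc (suc n)) _ (s≤s C≤n)))
                        (ℤₚ.+-inverseʳ (geometric C (suc n ∸ C)))
  ... | no  C≰n = cong₂ _-ℤ_ (geometric-∤ c (suc n) (λ C∣n → C≰n (∣⇒≤ C∣n)))
                             (when-no (C <? suc (suc n)) _ (λ C<n → C≰n (ℕₚ.≤-pred C<n)))

𝟙⊖X^∞ : (𝟙 ⊖ X^ ∞) ≗ 𝟙
𝟙⊖X^∞ n = ℤₚ.+-identityʳ (𝟙 n)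

-- Generating functions of partitions

partFactor : {T : Pred ℕ 0ℓ} → Decidable T → ℕ → Series
partFactor T? k with T? k
... | yes _ = geometric k
... | no _  = 𝟙

partsGF : {T : Pred ℕ 0ℓ} → Decidable T → ℕ → Series
partsGF T? = ∏≤ (partFactor T?)

partFactor-∈ : ∀ {T} (T? : Decidable T) k → T k → partFactor T? k ≗ geometric k
partFactor-∈ T? k k∈T with T? k
... | yes _   = ≗-refl
... | no k∉T = ⊥-elim (k∉T k∈T)

partFactor-∉ : ∀ {T} (T? : Decidable T) k → ¬ T k → partFactor T? k ≗ 𝟙
partFactor-∉ T? k k∉T with T? k
... | yes k∈T = ⊥-elim (k∉T k∈T)
... | no _    = ≗-refl

partsGF-∅ : ∀ {T} (T? : Decidable T) M → (∀ k → ¬ T (suc k)) → partsGF T? M ≗ 𝟙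
partsGF-∅ T? M T≡∅ = ∏≤-𝟙 (partFactor T?) M (λ k _ → partFactor-∉ T? (suc k) (T≡∅ k))

partsGF-⊎ : ∀ {T T₁ T₂} (T? : Decidable T) (T₁? : Decidable T₁) (T₂? : Decidable T₂) M →
  (∀ k → T (suc k) → T₁ (suc k) ⊎ T₂ (suc k)) → (∀ k → T₁ (suc k) ⊎ T₂ (suc k) → T (suc k)) →
  (∀ k → T₁ (suc k) → ¬ T₂ (suc k)) → partsGF T? M ≗ (partsGF T₁? M ⊛ partsGF T₂? M)
partsGF-⊎ {T} {T₁} {T₂} T? T₁? T₂? M ⊆⊎ ⊎⊆ disjoint n =
  trans (∏≤-cong M (λ k _ → factor k) n) (∏≤-⊛ (partFactor T₁?) (partFactor T₂?) M n)
  where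
  factor : ∀ k → partFactor T? (suc k) ≗ (partFactor T₁? (suc k) ⊛ partFactor T₂? (suc k))
  factor k with T? (suc k) | T₁? (suc k) | T₂? (suc k)
  ... | _       | yes k∈T₁ | yes k∈T₂ = ⊥-elim (disjoint k k∈T₁ k∈T₂)
  ... | yes k∈T | no k∉T₁  | no k∉T₂  = ⊥-elim ([ k∉T₁ , k∉T₂ ] (⊆⊎ k k∈T))
  ... | yes _   | yes _    | no _     = ≗-sym (⊛-identityʳ (geometric (suc k)))
  ... | yes _   | no _     | yes _    = ≗-sym (⊛-identityˡ (geometric (suc k)))
  ... | no k∉T  | yes k∈T₁ | _        = ⊥-elim (k∉T (⊎⊆ k (inj₁ k∈T₁)))
  ... | no k∉T  | _        | yes k∈T₂ = ⊥-elim (k∉T (⊎⊆ k (inj₂ k∈T₂)))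
  ... | no _    | no _     | no _     = ≗-sym (⊛-identityˡ 𝟙)

MultiplesReindexing : ℕ → ℕ → Set
MultiplesReindexing b M = Σ ℕ λ K → K * suc b ≤ M × M < suc K * suc b ×
  partsGF (inMultiples? (fin (suc b))) M ≗ ∏≤ (λ k → geometric (k * suc b)) K

multiplesReindexing-suc : ∀ b M → MultiplesReindexing b M → Dec (suc b ∣ suc M) → MultiplesReindexing b (suc M)
multiplesReindexing-suc b M (K , Kb≤M , M<K′b , eq) (yes (divides q 1+M≡qb)) =
  suc K , ℕₚ.≤-reflexive (sym 1+M≡K′b) , 1+M<K″b , ⊛-cong newFactor eq
  where
  q≡1+K : q ≡ suc K
  q≡1+K = ℕₚ.≤-antisym (ℕₚ.*-cancelʳ-≤ q (suc K) (suc b) (subst (_≤ suc K * suc b) 1+M≡qb M<K′b))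
                       (ℕₚ.*-cancelʳ-< (suc b) K q (subst (K * suc b <_) 1+M≡qb (s≤s Kb≤M)))
  1+M≡K′b : suc M ≡ suc K * suc b
  1+M≡K′b = trans 1+M≡qb (cong (_* suc b) q≡1+K)
  1+M<K″b : suc M < suc (suc K) * suc b
  1+M<K″b = subst (_< suc b + suc K * suc b) (sym 1+M≡K′b) (ℕₚ.m<n+m (suc K * suc b) (s≤s z≤n))
  newFactor : partFactor (inMultiples? (fin (suc b))) (suc M) ≗ geometric (suc K * suc b)
  newFactor n = trans (partFactor-∈ (inMultiples? (fin (suc b))) (suc M) (s≤s z≤n , divides q 1+M≡qb) n)
                      (cong (λ x → geometric x n) 1+M≡K′b)
multiplesReindexing-suc b M (K , Kb≤M , M<K′b , eq) (no b∤1+M) =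
  K , ℕₚ.m≤n⇒m≤1+n Kb≤M , ℕₚ.≤∧≢⇒< M<K′b (λ 1+M≡K′b → b∤1+M (divides (suc K) 1+M≡K′b)) , skip
  where
  T? : Decidable (InMultiples (fin (suc b)))
  T? = inMultiples? (fin (suc b))
  skip : partsGF T? (suc M) ≗ ∏≤ (λ k → geometric (k * suc b)) K
  skip n = trans (⊛-congˡ (partsGF T? M) (partFactor-∉ T? (suc M) (λ (_ , b∣1+M) → b∤1+M b∣1+M)) n)
                 (trans (⊛-identityˡ (partsGF T? M) n) (eq n))

multiplesReindexing : ∀ b M → MultiplesReindexing b M
multiplesReindexing b zero    = 0 , z≤n , s≤s z≤n , ≗-refl
multiplesReindexing b (suc M) = multiplesReindexing-suc b M (multiplesReindexing b M) (suc b ∣? suc M)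

dilations-geometric : ∀ b M → dilations M (geometric (suc b)) ≈[ M ] partsGF (inMultiples? (fin (suc b))) M
dilations-geometric b M with multiplesReindexing b M
... | K , Kb≤M , M<K′b , eq = begin
  dilations M (geometric (suc b))  ≈⟨ ≗⇒≈[] M (∏≤-cong M (λ k _ → dilate-geometric k b)) ⟩
  ∏≤ G M                           ≡⟨ cong (∏≤ G) (ℕₚ.m∸n+n≡m K≤M) ⟨
  ∏≤ G (M ∸ K + K)                 ≈⟨ ∏≤-extend G M K beyond (M ∸ K) ⟩
  ∏≤ G K                           ≈⟨ ≗⇒≈[] M eq ⟨
  partsGF (inMultiples? (fin (suc b))) M ∎
  where
  open ≈[]-Reasoning M
  G : ℕ → Series
  G k = geometric (k * suc b)
  K≤M : K ≤ M
  K≤M = ℕₚ.≤-trans (ℕₚ.m≤m*n K (suc b)) Kb≤M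
  beyond : ∀ k → K ≤ k → G (suc k) ≈[ M ] 𝟙
  beyond k K≤k = geometric-≈[]𝟙 (b + k * suc b) M (ℕₚ.<-≤-trans M<K′b (ℕₚ.*-monoˡ-≤ (suc b) (s≤s K≤k)))

partsGF-multiples-inverse : ∀ c M → c ≢ fin 0 → (partsGF (inMultiples? c) M ⊛ dilations M (𝟙 ⊖ X^ c)) ≈[ M ] 𝟙
partsGF-multiples-inverse (fin zero)    M c≢0 = ⊥-elim (c≢0 refl)
partsGF-multiples-inverse ∞             M _   = ≗⇒≈[] M (λ n → begin
  (partsGF (inMultiples? ∞) M ⊛ dilations M (𝟙 ⊖ X^ ∞)) n
    ≡⟨ ⊛-cong (partsGF-∅ (inMultiples? ∞) M (λ k ())) (λ i → trans (dilations-cong M 𝟙⊖X^∞ i) (dilations-𝟙 M i)) n ⟩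
  (𝟙 ⊛ 𝟙) n
    ≡⟨ ⊛-identityˡ 𝟙 n ⟩
  𝟙 n ∎)
  where open ≡-Reasoning
partsGF-multiples-inverse (fin (suc c)) M _   = begin
  partsGF (inMultiples? (fin C)) M ⊛ dilations M (𝟙 ⊖ X^ (fin C))
    ≈⟨ ⊛-congˡ-≈[] (dilations M (𝟙 ⊖ X^ (fin C))) (dilations-geometric c M) ⟨
  dilations M (geometric C) ⊛ dilations M (𝟙 ⊖ X^ (fin C))
    ≈⟨ ≗⇒≈[] M (dilations-⊛ M (geometric C) (𝟙 ⊖ X^ (fin C))) ⟨
  dilations M (geometric C ⊛ (𝟙 ⊖ X^ (fin C)))
    ≈⟨ ≗⇒≈[] M (dilations-cong M (geometric-inverse c)) ⟩
  dilations M 𝟙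
    ≈⟨ ≗⇒≈[] M (dilations-𝟙 M) ⟩
  𝟙 ∎
  where
  open ≈[]-Reasoning M
  C : ℕ
  C = suc c

·∞-nonzero : ∀ b e → (∀ d → e ≡ fin d → 1 ≤ d) → suc b ·∞ e ≢ fin 0
·∞-nonzero b ∞             _    ()
·∞-nonzero b (fin zero)    e≥1 _ = ℕₚ.<⇒≱ (e≥1 0 refl) z≤n
·∞-nonzero b (fin (suc d)) _    ()

InMultiples-·∞ : ∀ b e k → InMultiples (b ·∞ e) k → InMultiples (fin b) k
InMultiples-·∞ b (fin d) k (k≥1 , bd∣k) = k≥1 , ∣-trans (m∣m*n d) bd∣k

dilations-factor : ∀ b (δ : ℕ → ℕ∞) M → suc b ·∞ δ (suc b) ≢ fin 0 →
  dilations M ((𝟙 ⊖ X^ (suc b ·∞ δ (suc b))) ⊛ geometric (suc b)) ≈[ M ] partsGF (inS? δ (suc b)) M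
dilations-factor b δ M c≢0 = begin
  dilations M (E ⊛ geometric (suc b))
    ≈⟨ ≗⇒≈[] M (dilations-⊛ M E (geometric (suc b))) ⟩
  dilations M E ⊛ dilations M (geometric (suc b))
    ≈⟨ ⊛-congʳ-≈[] (dilations M E) (dilations-geometric b M) ⟩
  dilations M E ⊛ partsGF (inMultiples? (fin (suc b))) M
    ≈⟨ ≗⇒≈[] M (⊛-congʳ (dilations M E) multiples-split) ⟩
  dilations M E ⊛ (partsGF (inS? δ (suc b)) M ⊛ partsGF (inMultiples? c) M)
    ≈⟨ ≗⇒≈[] M (⊛-comm (dilations M E) (partsGF (inS? δ (suc b)) M ⊛ partsGF (inMultiples? c) M)) ⟩
  (partsGF (inS? δ (suc b)) M ⊛ partsGF (inMultiples? c) M) ⊛ dilations M E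
    ≈⟨ ≗⇒≈[] M (⊛-assoc (partsGF (inS? δ (suc b)) M) (partsGF (inMultiples? c) M) (dilations M E)) ⟩
  partsGF (inS? δ (suc b)) M ⊛ (partsGF (inMultiples? c) M ⊛ dilations M E)
    ≈⟨ ⊛-congʳ-≈[] (partsGF (inS? δ (suc b)) M) (partsGF-multiples-inverse c M c≢0) ⟩
  partsGF (inS? δ (suc b)) M ⊛ 𝟙
    ≈⟨ ≗⇒≈[] M (⊛-identityʳ (partsGF (inS? δ (suc b)) M)) ⟩
  partsGF (inS? δ (suc b)) M ∎
  where
  open ≈[]-Reasoning M
  c : ℕ∞
  c = suc b ·∞ δ (suc b)
  E : Series
  E = 𝟙 ⊖ X^ c
  multiples-split : partsGF (inMultiples? (fin (suc b))) M ≗ (partsGF (inS? δ (suc b)) M ⊛ partsGF (inMultiples? c) M)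
  multiples-split = partsGF-⊎ (inMultiples? (fin (suc b))) (inS? δ (suc b)) (inMultiples? c) M
    (λ k k∈bℕ → swap (map₂ (k∈bℕ ,_) (toSum (inMultiples? c (suc k)))))
    (λ k → [ proj₁ , InMultiples-·∞ (suc b) (δ (suc b)) (suc k) ])
    (λ k k∈S k∈cℕ → proj₂ k∈S k∈cℕ)

PairwiseDisjoint : (ℕ → ℕ∞) → List ℕ → Set
PairwiseDisjoint δ B = ∀ b b′ → b ∈ B → b′ ∈ B → b ≢ b′ → ∀ k → ¬ (InS δ b k × InS δ b′ k)

∏-partsGF-InS : ∀ (δ : ℕ → ℕ∞) M B → Unique B → PairwiseDisjoint δ B →
  ∏ B (λ b → partsGF (inS? δ b) M) ≗ partsGF (in𝓑? B δ) M
∏-partsGF-InS δ M []      _                 _        = ≗-sym (partsGF-∅ (in𝓑? [] δ) M (λ k ()))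
∏-partsGF-InS δ M (b ∷ B) (b∉B ∷ unique-B) disjoint n = trans
  (⊛-congʳ (partsGF (inS? δ b) M) (∏-partsGF-InS δ M B unique-B (λ x y x∈B y∈B → disjoint x y (there x∈B) (there y∈B))) n)
  (sym (partsGF-⊎ (in𝓑? (b ∷ B) δ) (inS? δ b) (in𝓑? B δ) M (λ k → In𝓑-∷⁻) (λ k → [ here , there ]) separate n))
  where
  In𝓑-∷⁻ : ∀ {k} → In𝓑 (b ∷ B) δ k → InS δ b k ⊎ In𝓑 B δ k
  In𝓑-∷⁻ (here k∈S)   = inj₁ k∈S
  In𝓑-∷⁻ (there k∈𝓑) = inj₂ k∈𝓑
  separate : ∀ k → InS δ b (suc k) → ¬ In𝓑 B δ (suc k)
  separate k k∈S k∈𝓑 with find k∈𝓑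
  ... | b′ , b′∈B , k∈S′ = disjoint b b′ (here refl) (there b′∈B) (All.lookup b∉B b′∈B) (suc k) (k∈S , k∈S′)

∏-geometric-inverse : ∀ B → All (1 ≤_) B → (∏ B (λ b → 𝟙 ⊖ X^ (fin b)) ⊛ ∏ B geometric) ≗ 𝟙
∏-geometric-inverse B B≥1 n = trans (sym (∏-⊛ (λ b → 𝟙 ⊖ X^ (fin b)) geometric B n))
                                    (∏-𝟙 _ B (λ b b∈B → inverse b (All.lookup B≥1 b∈B)) n)
  where
  inverse : ∀ b → 1 ≤ b → ((𝟙 ⊖ X^ (fin b)) ⊛ geometric b) ≗ 𝟙
  inverse (suc b) _ n = trans (⊛-comm (𝟙 ⊖ X^ (fin (suc b))) (geometric (suc b)) n) (geometric-inverse b n)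

divide-∏𝟙⊖X^ : ∀ f g B → All (1 ≤_) B → (f ⊛ ∏ B (λ b → 𝟙 ⊖ X^ (fin b))) ≗ g → f ≗ (g ⊛ ∏ B geometric)
divide-∏𝟙⊖X^ f g B B≥1 f⊛U≗g = begin
  f                  ≈⟨ ⊛-identityʳ f ⟨
  f ⊛ 𝟙              ≈⟨ ⊛-congʳ f (∏-geometric-inverse B B≥1) ⟨
  f ⊛ (U ⊛ G)        ≈⟨ ⊛-assoc f U G ⟨
  (f ⊛ U) ⊛ G        ≈⟨ ⊛-congˡ G f⊛U≗g ⟩
  g ⊛ G              ∎
  where
  open ≗-Reasoning
  U G : Series
  U = ∏ B (λ b → 𝟙 ⊖ X^ (fin b))
  G = ∏ B geometric

dilations-oneplus : ∀ (A : Pred ℕ 0ℓ) (A? : Decidable A) B → Unique B → All (1 ≤_) B →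
  ∀ (δ : ℕ → ℕ∞) → (∀ b → b ∈ B → ∀ d → δ b ≡ fin d → 1 ≤ d) →
  (oneplus A A? ⊛ ∏ B (λ b → 𝟙 ⊖ X^ (fin b))) ≗ ∏ B (λ b → 𝟙 ⊖ X^ (b ·∞ δ b)) →
  PairwiseDisjoint δ B →
  ∀ M → dilations M (oneplus A A?) ≈[ M ] partsGF (in𝓑? B δ) M
dilations-oneplus A A? B unique-B B≥1 δ δ≥1 identity disjoint M = begin
  dilations M (oneplus A A?)
    ≈⟨ ≗⇒≈[] M (dilations-cong M (divide-∏𝟙⊖X^ (oneplus A A?) (∏ B E) B B≥1 identity)) ⟩
  dilations M (∏ B E ⊛ ∏ B geometric)
    ≈⟨ ≗⇒≈[] M (dilations-cong M (∏-⊛ E geometric B)) ⟨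
  dilations M (∏ B (λ b → E b ⊛ geometric b))
    ≈⟨ ≗⇒≈[] M (dilations-∏ M (λ b → E b ⊛ geometric b) B) ⟩
  ∏ B (λ b → dilations M (E b ⊛ geometric b))
    ≈⟨ ∏-cong-≈[] B (λ b b∈B → factor b (All.lookup B≥1 b∈B) (δ≥1 b b∈B)) ⟩
  ∏ B (λ b → partsGF (inS? δ b) M)
    ≈⟨ ≗⇒≈[] M (∏-partsGF-InS δ M B unique-B disjoint) ⟩
  partsGF (in𝓑? B δ) M ∎
  where
  open ≈[]-Reasoning M
  E : ℕ → Series
  E b = 𝟙 ⊖ X^ (b ·∞ δ b)
  factor : ∀ b → 1 ≤ b → (∀ d → δ b ≡ fin d → 1 ≤ d) → dilations M (E b ⊛ geometric b) ≈[ M ] partsGF (inS? δ b) M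
  factor (suc b) _ δ≥1 = dilations-factor b δ M (·∞-nonzero b (δ (suc b)) δ≥1)

-- Enumerating partitions

module _ {A : Set} where

  ∈-─⁺ : ∀ {x z : A} {ys} (x∈ys : x ∈ ys) → z ∈ ys → z ≢ x → z ∈ ys ─ x∈ys
  ∈-─⁺ (here refl) (here refl) z≢x = ⊥-elim (z≢x refl)
  ∈-─⁺ (here refl) (there z∈ys) _  = z∈ys
  ∈-─⁺ (there _)   (here z≡y)   _  = here z≡y
  ∈-─⁺ (there x∈ys) (there z∈ys) z≢x = there (∈-─⁺ x∈ys z∈ys z≢x)

  Unique-length-≤ : ∀ {xs ys : List A} → Unique xs → xs ⊆ ys → length xs ≤ length ys
  Unique-length-≤ {[]}     _                xs⊆ys = z≤n
  Unique-length-≤ {x ∷ xs} {ys} (x∉xs ∷ unique) xs⊆ys =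
    subst (suc (length xs) ≤_) (sym (Listₚ.length-removeAt′ ys (index x∈ys)))
          (s≤s (Unique-length-≤ unique (λ z∈xs → ∈-─⁺ x∈ys (xs⊆ys (there z∈xs)) (λ z≡x → All.lookup x∉xs z∈xs (sym z≡x)))))
    where
    x∈ys : x ∈ ys
    x∈ys = xs⊆ys (here refl)

  Unique-length-≡ : ∀ {xs ys : List A} → Unique xs → Unique ys → xs ⊆ ys → ys ⊆ xs → length xs ≡ length ys
  Unique-length-≡ unique-xs unique-ys xs⊆ys ys⊆xs =
    ℕₚ.≤-antisym (Unique-length-≤ unique-xs xs⊆ys) (Unique-length-≤ unique-ys ys⊆xs)

  filter-cong-∈ : ∀ {P Q : Pred A 0ℓ} (P? : Decidable P) (Q? : Decidable Q) xs →
    (∀ x → x ∈ xs → P x → Q x) → (∀ x → x ∈ xs → Q x → P x) → filter P? xs ≡ filter Q? xs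
  filter-cong-∈ P? Q? []       _   _   = refl
  filter-cong-∈ P? Q? (x ∷ xs) P⇒Q Q⇒P with P? x | Q? x
  ... | yes _  | yes _  = cong (x ∷_) (filter-cong-∈ P? Q? xs (λ y y∈xs → P⇒Q y (there y∈xs)) (λ y y∈xs → Q⇒P y (there y∈xs)))
  ... | no _   | no _   = filter-cong-∈ P? Q? xs (λ y y∈xs → P⇒Q y (there y∈xs)) (λ y y∈xs → Q⇒P y (there y∈xs))
  ... | yes Px | no ¬Qx = ⊥-elim (¬Qx (P⇒Q x (here refl) Px))
  ... | no ¬Px | yes Qx = ⊥-elim (¬Px (Q⇒P x (here refl) Qx))

  length-filter-map : ∀ {P : Pred A 0ℓ} (P? : Decidable P) (f : A → A) xs →
    length (filter P? (map f xs)) ≡ length (filter (λ x → P? (f x)) xs)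
  length-filter-map P? f []       = refl
  length-filter-map P? f (x ∷ xs) with P? (f x)
  ... | yes _ = cong suc (length-filter-map P? f xs)
  ... | no _  = length-filter-map P? f xs

  length-filter-++ : ∀ {P : Pred A 0ℓ} (P? : Decidable P) xs ys →
    length (filter P? (xs ++ ys)) ≡ length (filter P? xs) + length (filter P? ys)
  length-filter-++ P? xs ys = trans (cong length (Listₚ.filter-++ P? xs ys)) (Listₚ.length-++ (filter P? xs))

mult-++ : ∀ x xs ys → mult x (xs ++ ys) ≡ mult x xs + mult x ys
mult-++ x = length-filter-++ (x ≟_)

mult-replicate : ∀ t j → mult t (replicate j t) ≡ j
mult-replicate t zero    = refl
mult-replicate t (suc j) =
  trans (cong length (Listₚ.filter-accept (t ≟_) {t} {replicate j t} refl)) (cong suc (mult-replicate t j))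

mult-replicate-≢ : ∀ x t j → x ≢ t → mult x (replicate j t) ≡ 0
mult-replicate-≢ x t zero    x≢t = refl
mult-replicate-≢ x t (suc j) x≢t =
  trans (cong length (Listₚ.filter-reject (x ≟_) {t} {replicate j t} x≢t)) (mult-replicate-≢ x t j x≢t)

mult-> : ∀ t l → All (_< t) l → mult t l ≡ 0
mult-> t l l<t = cong length (Listₚ.filter-none (t ≟_) (All.map ℕₚ.>⇒≢ l<t))

mult-replicate-++ : ∀ j t l → All (_< t) l → mult t (replicate j t ++ l) ≡ j
mult-replicate-++ j t l l<t =
  trans (mult-++ t (replicate j t) l) (trans (cong₂ _+_ (mult-replicate t j) (mult-> t l l<t)) (ℕₚ.+-identityʳ j))

mult-replicate-++-≢ : ∀ x j t l → x ≢ t → mult x (replicate j t ++ l) ≡ mult x l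
mult-replicate-++-≢ x j t l x≢t = trans (mult-++ x (replicate j t) l) (cong (_+ mult x l) (mult-replicate-≢ x t j x≢t))

∈-range1⁺ : ∀ m {x} → 1 ≤ x → x ≤ m → x ∈ range1 m
∈-range1⁺ zero    x≥1 x≤0 = ⊥-elim (ℕₚ.<⇒≱ x≥1 x≤0)
∈-range1⁺ (suc m) {x} x≥1 x≤1+m with x ≟ suc m
... | yes refl = ∈-++⁺ʳ (range1 m) (here refl)
... | no x≢1+m = ∈-++⁺ˡ (∈-range1⁺ m x≥1 (ℕₚ.≤-pred (ℕₚ.≤∧≢⇒< x≤1+m x≢1+m)))

∈-range1⁻ : ∀ m {x} → x ∈ range1 m → x ≤ m
∈-range1⁻ (suc m) x∈ with ∈-++⁻ (range1 m) x∈
... | inj₁ x∈range = ℕₚ.m≤n⇒m≤1+n (∈-range1⁻ m x∈range)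
... | inj₂ (here refl) = ℕₚ.≤-refl

range1-Unique : ∀ m → Unique (range1 m)
range1-Unique zero    = []
range1-Unique (suc m) = Uniqueₚ.++⁺ (range1-Unique m) ([] ∷ [])
  (λ { (x∈range , here refl) → ℕₚ.<⇒≱ (ℕₚ.n<1+n m) (∈-range1⁻ m x∈range) })

lists-suc : ∀ k m → lists (suc k) m ≡ [] ∷ cartesianProductWith _∷_ (range1 m) (lists k m)
lists-suc k m = cong ([] ∷_) (concatMap-cons (range1 m))
  where
  concatMap-cons : ∀ xs → concatMap (λ x → map (x ∷_) (lists k m)) xs ≡ cartesianProductWith _∷_ xs (lists k m)
  concatMap-cons []       = refl
  concatMap-cons (x ∷ xs) = cong (map (x ∷_) (lists k m) ++_) (concatMap-cons xs)

lists-Unique : ∀ k m → Unique (lists k m)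
lists-Unique zero    m = [] ∷ []
lists-Unique (suc k) m rewrite lists-suc k m =
  All.tabulate nonempty ∷ Uniqueₚ.cartesianProductWith⁺ _∷_ Listₚ.∷-injective (range1-Unique m) (lists-Unique k m)
  where
  nonempty : ∀ {l} → l ∈ cartesianProductWith _∷_ (range1 m) (lists k m) → [] ≢ l
  nonempty l∈ with ∈-cartesianProductWith⁻ _∷_ (range1 m) (lists k m) l∈
  ... | _ , _ , _ , _ , refl = λ ()

∈-lists⁺ : ∀ k m l → length l ≤ k → All (λ x → 1 ≤ x × x ≤ m) l → l ∈ lists k m
∈-lists⁺ zero    m []      _         _                    = here refl
∈-lists⁺ (suc k) m []      _         _                    = here refl
∈-lists⁺ (suc k) m (x ∷ l) (s≤s l≤k) ((x≥1 , x≤m) ∷ l∈m) rewrite lists-suc k m =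
  there (∈-cartesianProductWith⁺ _∷_ (∈-range1⁺ m x≥1 x≤m) (∈-lists⁺ k m l l≤k l∈m))

length≤sum : ∀ l → All (1 ≤_) l → length l ≤ sum l
length≤sum []      _           = z≤n
length≤sum (x ∷ l) (x≥1 ∷ l≥1) = ℕₚ.+-mono-≤ x≥1 (length≤sum l l≥1)

parts≤sum : ∀ l → All (_≤ sum l) l
parts≤sum []      = []
parts≤sum (x ∷ l) = ℕₚ.m≤m+n x (sum l) ∷ All.map (λ y≤ → ℕₚ.≤-trans y≤ (ℕₚ.m≤n+m (sum l) x)) (parts≤sum l)

∈-partitions⁺ : ∀ n l → IsPartition n l → l ∈ partitions n
∈-partitions⁺ n l l⊢n@(_ , l≥1 , refl) = ∈-filter⁺ (isPartition? n)
  (∈-lists⁺ n n l (length≤sum l l≥1) (All.zip (l≥1 , parts≤sum l))) l⊢n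

partitions-Unique : ∀ n → Unique (partitions n)
partitions-Unique n = Uniqueₚ.filter⁺ (isPartition? n) (lists-Unique n n)

-- The partitions of n into parts ≤ M, listed by the multiplicity j of the part M,
-- with its j copies in front.
layer : ℕ → (ℕ → List (List ℕ)) → ℕ → ℕ → List (List ℕ)
layer t e n j with j * t ≤? n
... | yes _ = map (replicate j t ++_) (e (n ∸ j * t))
... | no _  = []

layers : ℕ → (ℕ → List (List ℕ)) → ℕ → ℕ → List (List ℕ)
layers t e n zero    = []
layers t e n (suc J) = layers t e n J ++ layer t e n J

boundedPartitions : ℕ → ℕ → List (List ℕ)
boundedPartitions zero    zero    = [] ∷ []
boundedPartitions zero    (suc n) = []
boundedPartitions (suc M) n       = layers (suc M) (boundedPartitions M) n (suc n)

InLayer : ℕ → (ℕ → List (List ℕ)) → ℕ → ℕ → List ℕ → Set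
InLayer t e n j z = j * t ≤ n × Σ (List ℕ) λ l → l ∈ e (n ∸ j * t) × z ≡ replicate j t ++ l

∈-layer⁻ : ∀ t e n j {z} → z ∈ layer t e n j → InLayer t e n j z
∈-layer⁻ t e n j z∈ with j * t ≤? n
... | yes jt≤n with ∈-map⁻ (replicate j t ++_) z∈
...   | l , l∈ , refl = jt≤n , l , l∈ , refl

∈-layer⁺ : ∀ t e n j {l} → j * t ≤ n → l ∈ e (n ∸ j * t) → replicate j t ++ l ∈ layer t e n j
∈-layer⁺ t e n j jt≤n l∈ with j * t ≤? n
... | yes _    = ∈-map⁺ (replicate j t ++_) l∈
... | no jt≰n = ⊥-elim (jt≰n jt≤n)

∈-layers⁻ : ∀ t e n J {z} → z ∈ layers t e n J → Σ ℕ λ j → j < J × InLayer t e n j z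
∈-layers⁻ t e n (suc J) z∈ with ∈-++⁻ (layers t e n J) z∈
... | inj₁ z∈layers with ∈-layers⁻ t e n J z∈layers
...   | j , j<J , z∈j = j , ℕₚ.m<n⇒m<1+n j<J , z∈j
∈-layers⁻ t e n (suc J) z∈ | inj₂ z∈layer = J , ℕₚ.≤-refl , ∈-layer⁻ t e n J z∈layer

∈-layers⁺ : ∀ t e n J j {l} → j < J → j * t ≤ n → l ∈ e (n ∸ j * t) → replicate j t ++ l ∈ layers t e n J
∈-layers⁺ t e n (suc J) j j<1+J jt≤n l∈ with j ≟ J
... | yes refl = ∈-++⁺ʳ (layers t e n J) (∈-layer⁺ t e n j jt≤n l∈)
... | no j≢J   = ∈-++⁺ˡ (∈-layers⁺ t e n J j (ℕₚ.≤∧≢⇒< (ℕₚ.≤-pred j<1+J) j≢J) jt≤n l∈)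

sum-replicate : ∀ j t → sum (replicate j t) ≡ j * t
sum-replicate zero    t = refl
sum-replicate (suc j) t = cong (_+_ t) (sum-replicate j t)

Linked-≥-∷ : ∀ x xs → All (_≤ x) xs → Linked _≥_ xs → Linked _≥_ (x ∷ xs)
Linked-≥-∷ x []       _             _  = [-]
Linked-≥-∷ x (y ∷ ys) (y≤x ∷ _) linked = y≤x ∷ linked

Linked-≥-replicate-++ : ∀ j t l → All (_≤ t) l → Linked _≥_ l → Linked _≥_ (replicate j t ++ l)
Linked-≥-replicate-++ zero    t l l≤t linked = linked
Linked-≥-replicate-++ (suc j) t l l≤t linked =
  Linked-≥-∷ t _ (Allₚ.++⁺ (Allₚ.replicate⁺ j ℕₚ.≤-refl) l≤t) (Linked-≥-replicate-++ j t l l≤t linked)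

Linked-≥-drop : ∀ j t l → Linked _≥_ (replicate j t ++ l) → Linked _≥_ l
Linked-≥-drop zero    t l linked = linked
Linked-≥-drop (suc j) t l linked = Linked-≥-drop j t l (Linked.tail linked)

Linked-≥-head : ∀ x xs → Linked _≥_ (x ∷ xs) → All (_≤ x) xs
Linked-≥-head x []       _              = []
Linked-≥-head x (y ∷ ys) (y≤x ∷ linked) = y≤x ∷ All.map (λ z≤y → ℕₚ.≤-trans z≤y y≤x) (Linked-≥-head y ys linked)

SplitsAt : ℕ → List ℕ → Set
SplitsAt t l = Σ ℕ λ j → Σ (List ℕ) λ r → l ≡ replicate j t ++ r × All (_< t) r

splitAt : ∀ t l → Linked _≥_ l → All (_≤ t) l → SplitsAt t l
splitAt t []       _      _           = 0 , [] , refl , []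
splitAt t (x ∷ xs) linked (x≤t ∷ xs≤t) with x ≟ t
... | yes refl with splitAt x xs (Linked.tail linked) xs≤t
...   | j , r , refl , r<t = suc j , r , refl , r<t
splitAt t (x ∷ xs) linked (x≤t ∷ xs≤t) | no x≢t =
  0 , x ∷ xs , refl , x<t ∷ All.map (λ y≤x → ℕₚ.≤-<-trans y≤x x<t) (Linked-≥-head x xs linked)
  where
  x<t : x < t
  x<t = ℕₚ.≤∧≢⇒< x≤t x≢t

boundedPartitions-sound : ∀ M n {l} → l ∈ boundedPartitions M n → IsPartition n l × All (_≤ M) l
boundedPartitions-sound zero    zero    (here refl) = ([] , [] , refl) , []
boundedPartitions-sound (suc M) n l∈ with ∈-layers⁻ (suc M) (boundedPartitions M) n (suc n) l∈
... | j , _ , jt≤n , l , l∈ , refl with boundedPartitions-sound M (n ∸ j * suc M) l∈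
...   | (linked , l≥1 , sum≡) , l≤M =
  ( Linked-≥-replicate-++ j (suc M) l l≤1+M linked
  , Allₚ.++⁺ (Allₚ.replicate⁺ j (s≤s z≤n)) l≥1
  , trans (sum-++ (replicate j (suc M)) l) (trans (cong₂ _+_ (sum-replicate j (suc M)) sum≡) (ℕₚ.m+[n∸m]≡n jt≤n)) )
  , Allₚ.++⁺ (Allₚ.replicate⁺ j ℕₚ.≤-refl) l≤1+M
  where
  l≤1+M : All (_≤ suc M) l
  l≤1+M = All.map ℕₚ.m≤n⇒m≤1+n l≤M

boundedPartitions-complete : ∀ M n l → IsPartition n l → All (_≤ M) l → l ∈ boundedPartitions M n
boundedPartitions-complete zero    n []      (_ , _ , refl) _ = here refl
boundedPartitions-complete zero    n (x ∷ l) (_ , x≥1 ∷ _ , _) (x≤0 ∷ _) = ⊥-elim (ℕₚ.<⇒≱ x≥1 x≤0)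
boundedPartitions-complete (suc M) n l (linked , l≥1 , sum≡n) l≤1+M with splitAt (suc M) l linked l≤1+M
... | j , r , refl , r<1+M =
  ∈-layers⁺ t (boundedPartitions M) n (suc n) j (s≤s (ℕₚ.≤-trans (ℕₚ.m≤m*n j t) jt≤n)) jt≤n
    (boundedPartitions-complete M (n ∸ j * t) r
      (Linked-≥-drop j t r linked , Allₚ.++⁻ʳ (replicate j t) l≥1 , sum-r) (All.map ℕₚ.≤-pred r<1+M))
  where
  t : ℕ
  t = suc M
  jt+r≡n : j * t + sum r ≡ n
  jt+r≡n = trans (cong (_+ sum r) (sym (sum-replicate j t))) (trans (sym (sum-++ (replicate j t) r)) sum≡n)
  jt≤n : j * t ≤ n
  jt≤n = subst (j * t ≤_) jt+r≡n (ℕₚ.m≤m+n (j * t) (sum r))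
  sum-r : sum r ≡ n ∸ j * t
  sum-r = trans (sym (ℕₚ.m+n∸m≡n (j * t) (sum r))) (cong (_∸ j * t) jt+r≡n)

boundedPartitions-< : ∀ M m {l} → l ∈ boundedPartitions M m → All (_< suc M) l
boundedPartitions-< M m l∈ = All.map s≤s (proj₂ (boundedPartitions-sound M m l∈))

boundedPartitions-Unique : ∀ M n → Unique (boundedPartitions M n)
boundedPartitions-Unique zero    zero    = [] ∷ []
boundedPartitions-Unique zero    (suc n) = []
boundedPartitions-Unique (suc M) n       = layers-Unique (suc n)
  where
  t : ℕ
  t = suc M
  layer-Unique : ∀ j → Unique (layer t (boundedPartitions M) n j)
  layer-Unique j with j * t ≤? n
  ... | yes _ = Uniqueₚ.map⁺ (Listₚ.++-cancelˡ (replicate j t) _ _) (boundedPartitions-Unique M (n ∸ j * t))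
  ... | no _  = []
  layers-Unique : ∀ J → Unique (layers t (boundedPartitions M) n J)
  layers-Unique zero    = []
  layers-Unique (suc J) = Uniqueₚ.++⁺ (layers-Unique J) (layer-Unique J) disjoint
    where
    disjoint : Disjoint (layers t (boundedPartitions M) n J) (layer t (boundedPartitions M) n J)
    disjoint (z∈layers , z∈layer)
      with ∈-layers⁻ t (boundedPartitions M) n J z∈layers | ∈-layer⁻ t (boundedPartitions M) n J z∈layer
    ... | j , j<J , _ , l , l∈ , refl | _ , l′ , l′∈ , z≡ = ℕₚ.<-irrefl
      (trans (sym (mult-replicate-++ j t l (boundedPartitions-< M _ l∈)))
             (trans (cong (mult t) z≡) (mult-replicate-++ J t l′ (boundedPartitions-< M _ l′∈)))) j<J

-- Counting partitions with restricted multiplicities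

-- A part k may occur j > 0 times iff Φ k j.
module Counting (Φ : ℕ → ℕ → Set) (Φ? : ∀ k j → Dec (Φ k j)) where

  Admissible : List ℕ → Set
  Admissible l = All (λ x → Φ x (mult x l)) l

  multiplicities : ℕ → Series
  multiplicities k zero    = 1ℤ
  multiplicities k (suc j) = if does (Φ? k (suc j)) then 1ℤ else 0ℤ

  partitionsGF : ℕ → Series
  partitionsGF = ∏≤ (λ k → dilate k (multiplicities k))

  Admissible-tail : ∀ j t l → All (_< t) l → Admissible (replicate j t ++ l) → Admissible l
  Admissible-tail j t l l<t admissible = All.zipWith
    (λ (x<t , Φx) → subst (Φ _) (mult-replicate-++-≢ _ j t l (ℕₚ.<⇒≢ x<t)) Φx)
    (l<t , Allₚ.++⁻ʳ (replicate j t) admissible)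

  Admissible-head : ∀ j t l → All (_< t) l → Admissible (replicate (suc j) t ++ l) → Φ t (suc j)
  Admissible-head j t l l<t (Φt ∷ _) = subst (Φ t) (mult-replicate-++ (suc j) t l l<t) Φt

  Admissible-replicate-++ : ∀ j t l → All (_< t) l → Φ t j → Admissible l → Admissible (replicate j t ++ l)
  Admissible-replicate-++ j t l l<t Φtj admissible = Allₚ.++⁺
    (Allₚ.replicate⁺ j (subst (Φ t) (sym (mult-replicate-++ j t l l<t)) Φtj))
    (All.zipWith (λ (x<t , Φx) → subst (Φ _) (sym (mult-replicate-++-≢ _ j t l (ℕₚ.<⇒≢ x<t))) Φx)
                 (l<t , admissible))

  module _ (Admissible? : Decidable Admissible) where

    count : List (List ℕ) → ℤ
    count xs = + length (filter Admissible? xs)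

    count-++ : ∀ xs ys → count (xs ++ ys) ≡ count xs +ℤ count ys
    count-++ xs ys = trans (cong +_ (length-filter-++ Admissible? xs ys))
                           (ℤₚ.pos-+ (length (filter Admissible? xs)) (length (filter Admissible? ys)))

    count-prepend : ∀ t j xs → (∀ l → l ∈ xs → All (_< t) l) →
      count (map (replicate j t ++_) xs) ≡ multiplicities t j *ℤ count xs
    count-prepend t zero xs _ =
      trans (cong +_ (length-filter-map Admissible? ([] ++_) xs)) (sym (ℤₚ.*-identityˡ (count xs)))
    count-prepend t (suc j) xs xs<t =
      trans (cong +_ (length-filter-map Admissible? (replicate (suc j) t ++_) xs)) (filtered (Φ? t (suc j)))
      where
      filtered : (d : Dec (Φ t (suc j))) →
        + length (filter (λ l → Admissible? (replicate (suc j) t ++ l)) xs) ≡ (if does d then 1ℤ else 0ℤ) *ℤ count xs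
      filtered (yes Φtj) = trans (cong (λ ys → + length ys) (filter-cong-∈ _ Admissible? xs
                                   (λ l l∈ → Admissible-tail (suc j) t l (xs<t l l∈))
                                   (λ l l∈ → Admissible-replicate-++ (suc j) t l (xs<t l l∈) Φtj)))
                                 (sym (ℤₚ.*-identityˡ (count xs)))
      filtered (no ¬Φtj) = cong (λ ys → + length ys) (Listₚ.filter-none _ (All.tabulate λ {l} l∈ →
                             ¬Φtj ∘ Admissible-head j t l (xs<t l l∈)))

    count-boundedPartitions : ∀ M n → count (boundedPartitions M n) ≡ partitionsGF M n
    count-boundedPartitions zero    zero    = cong (λ ys → + length ys) (Listₚ.filter-accept Admissible? [])
    count-boundedPartitions zero    (suc n) = refl
    count-boundedPartitions (suc M) n = begin
      count (layers t e n (suc n))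
        ≡⟨ count-layers (suc n) ⟩
      sumTo (λ j → count (layer t e n j)) (suc n)
        ≡⟨ sumTo-cong (suc n) (λ j _ → count-layer j) ⟩
      sumTo (λ j → when (j * t ≤? n) (multiplicities t j *ℤ partitionsGF M (n ∸ j * t))) (suc n)
        ≡⟨ dilate-⊛-expand M (multiplicities t) (partitionsGF M) n ⟨
      partitionsGF (suc M) n ∎
      where
      open ≡-Reasoning
      t : ℕ
      t = suc M
      e : ℕ → List (List ℕ)
      e = boundedPartitions M
      count-layers : ∀ J → count (layers t e n J) ≡ sumTo (λ j → count (layer t e n j)) J
      count-layers zero    = refl
      count-layers (suc J) = trans (count-++ (layers t e n J) (layer t e n J)) (cong (_+ℤ count (layer t e n J)) (count-layers J))
      count-layer : ∀ j → count (layer t e n j) ≡ when (j * t ≤? n) (multiplicities t j *ℤ partitionsGF M (n ∸ j * t))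
      count-layer j with j * t ≤? n
      ... | yes _ = trans (count-prepend t j (e (n ∸ j * t)) (λ l → boundedPartitions-< M _))
                          (cong (multiplicities t j *ℤ_) (count-boundedPartitions M (n ∸ j * t)))
      ... | no _  = refl

    count-partitions : ∀ n → count (partitions n) ≡ partitionsGF n n
    count-partitions n = trans (cong +_ (Unique-length-≡
        (Uniqueₚ.filter⁺ Admissible? (partitions-Unique n))
        (Uniqueₚ.filter⁺ Admissible? (boundedPartitions-Unique n n))
        partitions⊆bounded bounded⊆partitions))
      (count-boundedPartitions n n)
      where
      partitions⊆bounded : filter Admissible? (partitions n) ⊆ filter Admissible? (boundedPartitions n n)
      partitions⊆bounded l∈ with ∈-filter⁻ Admissible? {xs = partitions n} l∈
      ... | l∈partitions , admissible with ∈-filter⁻ (isPartition? n) {xs = lists n n} l∈partitions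
      ...   | _ , l⊢n@(_ , _ , refl) = ∈-filter⁺ Admissible?
                (boundedPartitions-complete n _ _ l⊢n (parts≤sum _)) admissible
      bounded⊆partitions : filter Admissible? (boundedPartitions n n) ⊆ filter Admissible? (partitions n)
      bounded⊆partitions l∈ with ∈-filter⁻ Admissible? {xs = boundedPartitions n n} l∈
      ... | l∈bounded , admissible =
        ∈-filter⁺ Admissible? (∈-partitions⁺ n _ (proj₁ (boundedPartitions-sound n n l∈bounded))) admissible

module MultiplicitiesIn (A : Pred ℕ 0ℓ) (A? : Decidable A) where

  InA : ℕ → ℕ → Set
  InA _ j = A j

  inA? : ∀ k j → Dec (InA k j)
  inA? _ j = A? j

  open Counting InA inA? public

  partitionsGF≗dilations : ∀ M → partitionsGF M ≗ dilations M (oneplus A A?)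
  partitionsGF≗dilations M = ∏≤-cong M (λ k _ → dilate-cong (suc k) multiplicities≗oneplus)
    where
    multiplicities≗oneplus : ∀ {k} → multiplicities k ≗ oneplus A A?
    multiplicities≗oneplus zero    = refl
    multiplicities≗oneplus (suc j) = refl

module PartsIn {T : Pred ℕ 0ℓ} (T? : Decidable T) where

  InT : ℕ → ℕ → Set
  InT k _ = T k

  inT? : ∀ k j → Dec (InT k j)
  inT? k _ = T? k

  open Counting InT inT? public

  multiplicities-∈ : ∀ k → T k → multiplicities k ≗ allOnes
  multiplicities-∈ k k∈T zero    = refl
  multiplicities-∈ k k∈T (suc j) = cong (λ b → if b then 1ℤ else 0ℤ) (dec-true (T? k) k∈T)

  multiplicities-∉ : ∀ k → ¬ T k → multiplicities k ≗ 𝟙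
  multiplicities-∉ k k∉T zero    = refl
  multiplicities-∉ k k∉T (suc j) = cong (λ b → if b then 1ℤ else 0ℤ) (dec-false (T? k) k∉T)

  partsGF≗partitionsGF : ∀ M → partsGF T? M ≗ partitionsGF M
  partsGF≗partitionsGF M = ∏≤-cong M (λ k _ → factor k (T? (suc k)))
    where
    factor : ∀ k → Dec (T (suc k)) → partFactor T? (suc k) ≗ dilate (suc k) (multiplicities (suc k))
    factor k (yes k∈T) n = trans (partFactor-∈ T? (suc k) k∈T n)
                                 (dilate-cong (suc k) (≗-sym (multiplicities-∈ (suc k) k∈T)) n)
    factor k (no k∉T)  n = trans (partFactor-∉ T? (suc k) k∉T n)
                                 (trans (sym (dilate-𝟙 k n)) (dilate-cong (suc k) (≗-sym (multiplicities-∉ (suc k) k∉T)) n))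

theorem2p1 : (A : Pred ℕ 0ℓ) (A? : Decidable A)
    → (B : List ℕ) → Unique B → All (1 ≤_) B
    → (δ : ℕ → ℕ∞) → (∀ b → b ∈ B → ∀ d → δ b ≡ fin d → 1 ≤ d)
    → (∀ n → (oneplus A A? ⊛ ∏ B (λ b → 𝟙 ⊖ X^ (fin b))) n ≡ ∏ B (λ b → 𝟙 ⊖ X^ (b ·∞ δ b)) n)
    → (∀ b b' → b ∈ B → b' ∈ B → b ≢ b' → ∀ k → ¬ (InS δ b k × InS δ b' k))
    → ∀ n → 1 ≤ n → P A A? n ≡ Q (In𝓑 B δ) (in𝓑? B δ) n
theorem2p1 A A? B unique-B B≥1 δ δ≥1 identity disjoint n _ = ℤₚ.+-injective (begin
  + P A A? n
    ≡⟨ A-restricted.count-partitions (λ l → all? (λ x → A? (mult x l)) l) n ⟩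
  A-restricted.partitionsGF n n
    ≡⟨ A-restricted.partitionsGF≗dilations n n ⟩
  dilations n (oneplus A A?) n
    ≡⟨ dilations-oneplus A A? B unique-B B≥1 δ δ≥1 identity disjoint n n ℕₚ.≤-refl ⟩
  partsGF (in𝓑? B δ) n n
    ≡⟨ 𝓑-restricted.partsGF≗partitionsGF n n ⟩
  𝓑-restricted.partitionsGF n n
    ≡⟨ 𝓑-restricted.count-partitions (all? (in𝓑? B δ)) n ⟨
  + Q (In𝓑 B δ) (in𝓑? B δ) n ∎)
  where
  open ≡-Reasoning
  module A-restricted = MultiplicitiesIn A A?
  module 𝓑-restricted = PartsIn (in𝓑? B δ)
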